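{- For every $1\le i<n$: $\hat u_i\not\approx\hat u_{i+1}$ if and only if the complete subtree rooted at $\hat u_i$ (i.e., $\hat u_i$ and all its descendants) contains a red node.
   Context: A trie is a rooted tree with $n$ nodes whose edges are labeled with characters of $\Sigma$, totally ordered by $\prec$, such that the edges leaving any node carry pairwise distinct labels. $\lambda(\hat u)$ is the label of the edge entering $\hat u$ (the root gets $\#$, the smallest character, labeling no edge). $child_c(\hat u)$ is the child of $\hat u$ reached via the edge labeled $c$ (or $\bot$), and $out(\hat u)$ is the set of labels of edges leaving $\hat u$. Nodes are sorted co-lexicographically (root-to-node label strings compared right-to-left with $\prec$): $\hat u_1<\dots<\hat u_n$. A node $\hat u_i$ with $i<n$ is red if $out(\hat u_i)\ne out(\hat u_{i+1})$; $\hat u_n$ is not red. Isomorphism: $\hat u\approx\hat v$ iff for every $c\in\Sigma$, $child_c(\hat u)\approx child_c(\hat v)$, where $\hat x\approx\bot$ iff $\hat x=\bot$. -}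

module Defs where

open import Level using (Level; _⊔_)
open import Data.Product using (Σ; ∃; _×_; _,_; proj₁; proj₂)
open import Data.List using (List; []; _∷_; _++_; reverse)
open import Data.List.Relation.Unary.All using (All)
open import Data.List.Relation.Unary.AllPairs using (AllPairs)
open import Data.List.Relation.Binary.Lex.Core using (Lex-<)
open import Data.Maybe using (Maybe; just; nothing; _>>=_)
open import Data.Maybe.Relation.Binary.Pointwise using (Pointwise)
open import Data.Nat using (ℕ; suc)
open import Data.Fin using (Fin; inject₁)
open import Relation.Binary using (Rel; IsStrictTotalOrder)
open import Relation.Binary.PropositionalEquality using (_≡_; _≢_)
open import Relation.Nullary using (¬_; yes; no)
open import Function.Bundles using (_⇔_)

-- The special character # (smallest,
-- labelling no edge) is not an element of A; it is accounted for in the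
-- co-lexicographic order below (the shorter string is smaller when one
-- reversed string is a prefix of the other).
module Tries {a ℓ : Level} (A : Set a) (_≺_ : Rel A ℓ)
             (sto : IsStrictTotalOrder _≡_ _≺_) where

  open IsStrictTotalOrder sto using (_≟_)

  data Trie : Set a where
    node : List (A × Trie) → Trie

  data WellFormed : Trie → Set a where
    wf : ∀ {xs} → AllPairs (λ e f → proj₁ e ≢ proj₁ f) xs
       → All (λ e → WellFormed (proj₂ e)) xs
       → WellFormed (node xs)

  lookupEdge : A → List (A × Trie) → Maybe Trie
  lookupEdge c [] = nothing
  lookupEdge c ((d , s) ∷ xs) with c ≟ d
  ... | yes _ = just s
  ... | no  _ = lookupEdge c xs

  child : A → Trie → Maybe Trie
  child c (node xs) = lookupEdge c xs

  -- A node of t is identified with its root-to-node label string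
  -- (root first).  sub t p = the subtree rooted at the node reached by p.
  sub : Trie → List A → Maybe Trie
  sub t []      = just t
  sub t (c ∷ p) = child c t >>= λ s → sub s p

  IsNode : Trie → List A → Set a
  IsNode t p = ∃ λ s → sub t p ≡ just s

  InOut : Trie → List A → A → Set a
  InOut t p c = IsNode t (p ++ c ∷ [])

  SameOut : Trie → List A → List A → Set a
  SameOut t p q = ∀ c → InOut t p c ⇔ InOut t q c

  data _≈T_ : Trie → Trie → Set a where
    iso : ∀ {u v} → (∀ c → Pointwise _≈T_ (child c u) (child c v)) → u ≈T v

  IsoNodes : Trie → List A → List A → Set a
  IsoNodes t p q = Pointwise _≈T_ (sub t p) (sub t q)

  _<colex_ : List A → List A → Set (a ⊔ ℓ)
  p <colex q = Lex-< _≡_ _≺_ (reverse p) (reverse q)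

  record ColexSorted (t : Trie) (m : ℕ) (u : Fin (suc m) → List A) : Set (a ⊔ ℓ) where
    field
      nodes    : ∀ i → IsNode t (u i)
      complete : ∀ p → IsNode t p → ∃ λ i → u i ≡ p
      sorted   : ∀ i → u (inject₁ i) <colex u (Fin.suc i)

  -- The j-th node (j < n, 0-based j : Fin m) is red iff out(u_j) ≠ out(u_{j+1}).
  -- The last node u m is never red (it is not indexed by Fin m).
  Red : Trie → (m : ℕ) → (Fin (suc m) → List A) → Fin m → Set a
  Red t m u j = ¬ SameOut t (u (inject₁ j)) (u (Fin.suc j))

  InSubtree : List A → List A → Set a
  InSubtree p q = ∃ λ r → q ≡ p ++ r

{-# OPTIONS --safe #-}
module Submission where

-- If u_k·c and u_{k+1}·c are both nodes, they are consecutive in co-lex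
-- order: a node strictly between them ends in c, and its parent would lie
-- strictly between u_k and u_{k+1}.  So an isomorphism u_i ≈ u_{i+1}
-- propagates to the consecutive pairs (u_i·r, u_{i+1}·r) for every
-- descendant u_i·r, and isomorphic nodes have equal out-sets: no descendant
-- is red.  Conversely, if u_i ≈ u_{i+1} fails then either out(u_i) differs
-- from out(u_{i+1}), so u_i is red, or some pair of c-children, again a
-- consecutive pair, is not isomorphic; well-founded induction on the
-- subtree finds the red node.

open import Defs
open import Level using (Level; _⊔_)
open import Data.Nat using (ℕ; suc; z<s; s<s⁻¹; s≤s⁻¹) renaming (_<_ to _<ℕ_)
import Data.Nat.Properties as ℕ
open import Data.Fin using (Fin; zero; suc; inject₁; toℕ; _<_)
import Data.Fin.Properties as Fin
open import Data.List using (List; []; _∷_; _++_; _∷ʳ_; reverse; map)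
open import Data.List.Properties using (++-assoc; ++-identityʳ; reverse-++; reverse-involutive; unfold-reverse)
import Data.List.Relation.Binary.Pointwise as ListPointwise
open import Data.List.Relation.Binary.Lex.Strict using (Lex-<; this; next; <-irreflexive; <-transitive)
open import Data.List.Relation.Unary.All as All using (All)
open import Data.List.Relation.Unary.Any using (here; there)
open import Data.List.Membership.Propositional using (_∈_; _∉_)
open import Data.List.Membership.Propositional.Properties using (∈-++⁺ˡ; ∈-++⁺ʳ)
import Data.List.Membership.DecPropositional as DecMembership
open import Data.Maybe using (Maybe; just; nothing; _>>=_)
open import Data.Maybe.Properties using (just-injective)
open import Data.Maybe.Relation.Binary.Pointwise using (Pointwise; just; nothing)
open import Data.Product using (∃; _×_; _,_; proj₁)
open import Data.Sum using (_⊎_; inj₁; inj₂; [_,_]′) renaming (map to ⊎-map)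
import Data.Sum.Effectful.Right as SumRight
open import Data.Empty using (⊥-elim)
open import Function using (_∘_; id)
open import Function.Bundles using (_⇔_; mk⇔; Equivalence)
open import Induction.WellFounded using (WellFounded; Acc; acc)
open import Relation.Binary using (Rel; Transitive; IsStrictTotalOrder; DecidableEquality; tri<; tri≈; tri>)
open import Relation.Binary.PropositionalEquality using (_≡_; refl; sym; trans; cong; subst; subst₂)
open import Relation.Nullary using (¬_; yes; no)

module _ {b r} {X : Set b} {_R_ : Rel X r} (R-trans : Transitive _R_) where

  stepwise⇒strictlyMonotone : ∀ {n} (f : Fin (suc n) → X) → (∀ i → f (inject₁ i) R f (suc i))
    → ∀ {i j} → i < j → f i R f j
  stepwise⇒strictlyMonotone f step {zero}  {zero}        ()
  stepwise⇒strictlyMonotone f step {suc i} {zero}        ()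
  stepwise⇒strictlyMonotone f step {zero}  {suc zero}    _   = step zero
  stepwise⇒strictlyMonotone f step {zero}  {suc (suc j)} _   =
    R-trans (step zero) (stepwise⇒strictlyMonotone (f ∘ suc) (step ∘ suc) {zero} {suc j} z<s)
  stepwise⇒strictlyMonotone {suc _} f step {suc i} {suc j} i<j =
    stepwise⇒strictlyMonotone (f ∘ suc) (step ∘ suc) (s<s⁻¹ i<j)

no-index-between : ∀ {m} {k : Fin m} {i : Fin (suc m)} → inject₁ k < i → ¬ i < suc k
no-index-between {k = k} {i} k<i i<k+1 =
  ℕ.<⇒≱ (subst (_<ℕ toℕ i) (Fin.toℕ-inject₁ k) k<i) (s≤s⁻¹ i<k+1)

module _ {a} {A : Set a} (_≟_ : DecidableEquality A) where
  open DecMembership _≟_ using (_∈?_)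

  sequence-∀-cofinite : ∀ {P : A → Set a} {Q : Set a} (cs : List A) → (∀ c → c ∉ cs → P c)
    → (∀ c → P c ⊎ Q) → (∀ c → P c) ⊎ Q
  sequence-∀-cofinite {P} {Q} cs outside choose =
    ⊎-map everywhere id (All.sequenceA a (SumRight.applicative a Q) (All.tabulate λ {c} _ → choose c))
    where
    everywhere : All P cs → ∀ c → P c
    everywhere Ps c with c ∈? cs
    ... | yes c∈cs = All.lookup Ps c∈cs
    ... | no  c∉cs = outside c c∉cs

module TrieTheory {a ℓ : Level} (A : Set a) (_≺_ : Rel A ℓ) (sto : IsStrictTotalOrder _≡_ _≺_) where
  open Tries A _≺_ sto public
  open IsStrictTotalOrder sto using (_≟_; isEquivalence; <-resp-≈) renaming (trans to ≺-trans; irrefl to ≺-irrefl)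

  _<lex_ : Rel (List A) (a ⊔ ℓ)
  _<lex_ = Lex-< _≡_ _≺_

  colex-trans : ∀ p q r → p <colex q → q <colex r → p <colex r
  colex-trans _ _ _ = <-transitive isEquivalence <-resp-≈ ≺-trans

  colex-irrefl : ∀ p → ¬ p <colex p
  colex-irrefl _ = <-irreflexive ≺-irrefl (ListPointwise.≡⇒Pointwise-≡ refl)

  ∷ʳ-colex-mono : ∀ p q c → p <colex q → (p ∷ʳ c) <colex (q ∷ʳ c)
  ∷ʳ-colex-mono p q c p<q rewrite reverse-++ p (c ∷ []) | reverse-++ q (c ∷ []) = next refl p<q

  lex-between-∷ : ∀ {c xs ys zs} → (c ∷ xs) <lex zs → zs <lex (c ∷ ys)
    → ∃ λ zs′ → zs ≡ c ∷ zs′ × xs <lex zs′ × zs′ <lex ys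
  lex-between-∷ (this c≺d)     (this d≺c)     = ⊥-elim (≺-irrefl refl (≺-trans c≺d d≺c))
  lex-between-∷ (this c≺c)     (next refl _)  = ⊥-elim (≺-irrefl refl c≺c)
  lex-between-∷ (next refl _)  (this c≺c)     = ⊥-elim (≺-irrefl refl c≺c)
  lex-between-∷ (next refl xs<zs) (next refl zs<ys) = _ , refl , xs<zs , zs<ys

  colex-between-∷ʳ : ∀ {p q c} z → (p ∷ʳ c) <colex z → z <colex (q ∷ʳ c)
    → ∃ λ z′ → z ≡ z′ ∷ʳ c × p <colex z′ × z′ <colex q
  colex-between-∷ʳ {p} {q} {c} z pc<z z<qc
    rewrite reverse-++ p (c ∷ []) | reverse-++ q (c ∷ [])
    with lex-between-∷ pc<z z<qc
  ... | zs , rz≡ , p<zs , zs<q =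
    reverse zs , z≡ ,
    subst (reverse p <lex_) (sym (reverse-involutive zs)) p<zs ,
    subst (_<lex reverse q) (sym (reverse-involutive zs)) zs<q
    where
    z≡ : z ≡ reverse zs ∷ʳ c
    z≡ = trans (sym (reverse-involutive z)) (trans (cong reverse rz≡) (unfold-reverse c zs))

  sub-++ : ∀ t p q → sub t (p ++ q) ≡ (sub t p >>= λ s → sub s q)
  sub-++ t []      q = refl
  sub-++ t (c ∷ p) q with child c t
  ... | just s  = sub-++ s p q
  ... | nothing = refl

  sub-∷ʳ : ∀ t p c → sub t (p ∷ʳ c) ≡ (sub t p >>= child c)
  sub-∷ʳ t []      c with child c t
  ... | just _  = refl
  ... | nothing = refl
  sub-∷ʳ t (d ∷ p) c with child d t
  ... | just s  = sub-∷ʳ s p c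
  ... | nothing = refl

  sub-child : ∀ {s} t p c → sub t p ≡ just s → sub t (p ∷ʳ c) ≡ child c s
  sub-child t p c eq = trans (sub-∷ʳ t p c) (cong (_>>= child c) eq)

  IsNode-prefix : ∀ {t} p q → IsNode t (p ++ q) → IsNode t p
  IsNode-prefix {t} p q (s , eq) with sub t p | sub-++ t p q
  ... | just s′ | _   = s′ , refl
  ... | nothing | eq′ with () ← trans (sym eq) eq′

  InSubtree-trans : ∀ {p q r} → InSubtree p q → InSubtree q r → InSubtree p r
  InSubtree-trans {p} (xs , refl) (ys , refl) = xs ++ ys , ++-assoc p xs ys

  labels : Trie → List A
  labels (node xs) = map proj₁ xs

  lookupEdge-∉ : ∀ {c} xs → c ∉ map proj₁ xs → lookupEdge c xs ≡ nothing
  lookupEdge-∉     []             _   = refl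
  lookupEdge-∉ {c} ((d , _) ∷ xs) c∉ with c ≟ d
  ... | yes c≡d = ⊥-elim (c∉ (here c≡d))
  ... | no  _   = lookupEdge-∉ xs (c∉ ∘ there)

  child-∉ : ∀ {c} s → c ∉ labels s → child c s ≡ nothing
  child-∉ (node xs) = lookupEdge-∉ xs

  lookupEdge-∈ : ∀ {c s} xs → lookupEdge c xs ≡ just s → (c , s) ∈ xs
  lookupEdge-∈ {c} ((d , _) ∷ xs) eq with c ≟ d
  ... | yes refl = here (cong (c ,_) (sym (just-injective eq)))
  ... | no  _    = there (lookupEdge-∈ xs eq)

  _ChildOf_ : Rel Trie a
  s₁ ChildOf s = ∃ λ c → child c s ≡ just s₁

  childOf-wellFounded : WellFounded _ChildOf_
  edge-acc : ∀ {c s} xs → (c , s) ∈ xs → Acc _ChildOf_ s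

  childOf-wellFounded (node xs) = acc λ (_ , eq) → edge-acc xs (lookupEdge-∈ xs eq)

  edge-acc ((_ , s) ∷ _) (here refl) = childOf-wellFounded s
  edge-acc (_ ∷ xs)      (there e)   = edge-acc xs e

  pointwise-just⇔ : ∀ {mx my : Maybe Trie} → Pointwise _≈T_ mx my
    → (∃ λ x → mx ≡ just x) ⇔ (∃ λ y → my ≡ just y)
  pointwise-just⇔ (just {y = y} _) = mk⇔ (λ _ → y , refl) (λ _ → _ , refl)
  pointwise-just⇔ nothing          = mk⇔ (λ { (_ , ()) }) (λ { (_ , ()) })

  pointwise-child : ∀ c {mx my} → Pointwise _≈T_ mx my → Pointwise _≈T_ (mx >>= child c) (my >>= child c)
  pointwise-child c (just (iso children)) = children c
  pointwise-child c nothing               = nothing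

  IsoNodes-∷ʳ : ∀ t p q c → IsoNodes t p q → IsoNodes t (p ∷ʳ c) (q ∷ʳ c)
  IsoNodes-∷ʳ t p q c p≈q rewrite sub-∷ʳ t p c | sub-∷ʳ t q c = pointwise-child c p≈q

  IsoNodes⇒SameOut : ∀ t p q → IsoNodes t p q → SameOut t p q
  IsoNodes⇒SameOut t p q p≈q c = pointwise-just⇔ (IsoNodes-∷ʳ t p q c p≈q)

  InOut-mismatch : ∀ {s s′ s₁} t p q c → sub t p ≡ just s → sub t q ≡ just s′
    → child c s ≡ just s₁ → child c s′ ≡ nothing → ¬ (InOut t p c → InOut t q c)
  InOut-mismatch t p q c eqp eqq e₁ e₂ p→q with p→q (_ , trans (sub-child t p c eqp) e₁)
  ... | _ , e with () ← trans (sym e) (trans (sub-child t q c eqq) e₂)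

  module Enumeration (t : Trie) (m : ℕ) (u : Fin (suc m) → List A) (enum : ColexSorted t m u) where
    open ColexSorted enum

    lower upper : Fin m → List A
    lower k = u (inject₁ k)
    upper k = u (suc k)

    u-monotone : ∀ {i j} → i < j → u i <colex u j
    u-monotone = stepwise⇒strictlyMonotone {_R_ = _<colex_} (λ {p q r} → colex-trans p q r) u sorted

    u-reflects : ∀ {i j} → u i <colex u j → i < j
    u-reflects {i} {j} ui<uj with Fin.<-cmp i j
    ... | tri< i<j _ _ = i<j
    ... | tri≈ _ refl _ = ⊥-elim (colex-irrefl (u i) ui<uj)
    ... | tri> _ _ j<i =
      ⊥-elim (colex-irrefl (u i) (colex-trans (u i) (u j) (u i) ui<uj (u-monotone j<i)))

    u-injective : ∀ {i j} → u i ≡ u j → i ≡ j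
    u-injective {i} {j} ui≡uj with Fin.<-cmp i j
    ... | tri< i<j _ _ = ⊥-elim (colex-irrefl (u j) (subst (_<colex u j) ui≡uj (u-monotone i<j)))
    ... | tri≈ _ i≡j _ = i≡j
    ... | tri> _ _ j<i = ⊥-elim (colex-irrefl (u j) (subst (u j <colex_) ui≡uj (u-monotone j<i)))

    no-node-between : ∀ k c z → (lower k ∷ʳ c) <colex z → z <colex (upper k ∷ʳ c) → ¬ IsNode t z
    no-node-between k c z above below z-node
      with colex-between-∷ʳ {lower k} {upper k} {c} z above below
    ... | z′ , refl , lk<z′ , z′<uk with complete z′ (IsNode-prefix z′ (c ∷ []) z-node)
    ... | i , refl = no-index-between (u-reflects lk<z′) (u-reflects z′<uk)

    gap⇒successor : ∀ {i j} → i < j → (∀ z → u i <colex z → z <colex u j → ¬ IsNode t z)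
      → ∃ λ k → inject₁ k ≡ i × suc k ≡ j
    gap⇒successor {i} {suc k} i<j gap with Fin.<-cmp i (inject₁ k)
    ... | tri< i<k _ _ =
      ⊥-elim (gap (lower k) (u-monotone i<k) (u-monotone (Fin.≤̄⇒inject₁< Fin.≤-refl)) (nodes (inject₁ k)))
    ... | tri≈ _ i≡k _ = k , sym i≡k , refl
    ... | tri> _ _ k<i = ⊥-elim (no-index-between k<i i<j)

    adjacent-nodes : ∀ {p q} → IsNode t p → IsNode t q → p <colex q
      → (∀ z → p <colex z → z <colex q → ¬ IsNode t z)
      → ∃ λ k → lower k ≡ p × upper k ≡ q
    adjacent-nodes {p} {q} p-node q-node p<q gap with complete p p-node | complete q q-node
    ... | i , refl | j , refl with gap⇒successor (u-reflects p<q) gap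
    ... | k , refl , refl = k , refl , refl

    consecutive-children : ∀ k c → IsNode t (lower k ∷ʳ c) → IsNode t (upper k ∷ʳ c)
      → ∃ λ k′ → lower k′ ≡ lower k ∷ʳ c × upper k′ ≡ upper k ∷ʳ c
    consecutive-children k c lower-child upper-child =
      adjacent-nodes lower-child upper-child (∷ʳ-colex-mono (lower k) (upper k) c (sorted k))
                     (no-node-between k c)

    iso-descends : ∀ {k j} r → lower j ≡ lower k ++ r
      → IsoNodes t (lower k) (upper k) → IsoNodes t (lower j) (upper j)
    iso-descends {k} [] lj≡ k-iso
      with Fin.inject₁-injective (u-injective (trans lj≡ (++-identityʳ (lower k))))
    ... | refl = k-iso
    iso-descends {k} {j} (c ∷ r) lj≡ k-iso =
      let k′ , lk′≡ , uk′≡ = consecutive-children k c lower-child upper-child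
      in iso-descends r (trans lj≡′ (cong (_++ r) (sym lk′≡)))
           (subst₂ (IsoNodes t) (sym lk′≡) (sym uk′≡) (IsoNodes-∷ʳ t (lower k) (upper k) c k-iso))
      where
      lj≡′ : lower j ≡ (lower k ∷ʳ c) ++ r
      lj≡′ = trans lj≡ (sym (++-assoc (lower k) (c ∷ []) r))
      lower-child : IsNode t (lower k ∷ʳ c)
      lower-child = IsNode-prefix (lower k ∷ʳ c) r (subst (IsNode t) lj≡′ (nodes (inject₁ j)))
      upper-child : IsNode t (upper k ∷ʳ c)
      upper-child = Equivalence.to (IsoNodes⇒SameOut t (lower k) (upper k) k-iso c) lower-child

    RedBelow : Fin m → Set a
    RedBelow k = ∃ λ j → InSubtree (lower k) (lower j) × Red t m u j

    iso⊎redBelow : ∀ {s} → Acc _ChildOf_ s → ∀ k → sub t (lower k) ≡ just s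
      → IsoNodes t (lower k) (upper k) ⊎ RedBelow k
    iso⊎redBelow {s} (acc below) k eqₗ with nodes (suc k)
    ... | s′ , eqᵤ =
      ⊎-map (λ children → subst₂ (Pointwise _≈T_) (sym eqₗ) (sym eqᵤ) (just (iso children))) id
            (sequence-∀-cofinite _≟_ (labels s ++ labels s′) outside childIso⊎redBelow)
      where
      outside : ∀ c → c ∉ labels s ++ labels s′ → Pointwise _≈T_ (child c s) (child c s′)
      outside c c∉ rewrite child-∉ s (c∉ ∘ ∈-++⁺ˡ) | child-∉ s′ (c∉ ∘ ∈-++⁺ʳ (labels s)) = nothing

      red-here : Red t m u k → RedBelow k
      red-here red = k , ([] , sym (++-identityʳ (lower k))) , red

      childIso⊎redBelow : ∀ c → Pointwise _≈T_ (child c s) (child c s′) ⊎ RedBelow k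
      childIso⊎redBelow c with child c s in e₁ | child c s′ in e₂
      ... | nothing | nothing = inj₁ nothing
      ... | just _  | nothing = inj₂ (red-here λ same →
        InOut-mismatch t (lower k) (upper k) c eqₗ eqᵤ e₁ e₂ (Equivalence.to (same c)))
      ... | nothing | just _  = inj₂ (red-here λ same →
        InOut-mismatch t (upper k) (lower k) c eqᵤ eqₗ e₂ e₁ (Equivalence.from (same c)))
      ... | just s₁ | just s₂
        with consecutive-children k c (s₁ , trans (sub-child t (lower k) c eqₗ) e₁)
                                      (s₂ , trans (sub-child t (upper k) c eqᵤ) e₂)
      ...   | k′ , lk′≡ , uk′≡ =
        ⊎-map (subst₂ (Pointwise _≈T_) sub-lk′ sub-uk′) redBelow-up
              (iso⊎redBelow (below (c , e₁)) k′ sub-lk′)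
        where
        sub-lk′ : sub t (lower k′) ≡ just s₁
        sub-lk′ = trans (cong (sub t) lk′≡) (trans (sub-child t (lower k) c eqₗ) e₁)
        sub-uk′ : sub t (upper k′) ≡ just s₂
        sub-uk′ = trans (cong (sub t) uk′≡) (trans (sub-child t (upper k) c eqᵤ) e₂)
        redBelow-up : RedBelow k′ → RedBelow k
        redBelow-up (j , k′≤j , red) = j , InSubtree-trans (c ∷ [] , lk′≡) k′≤j , red

corollary1 : ∀ {a ℓ : Level} (A : Set a) (_≺_ : Rel A ℓ) (sto : IsStrictTotalOrder _≡_ _≺_)
    → let open Tries A _≺_ sto in
      (t : Trie) → WellFormed t
    → (m : ℕ) (u : Fin (suc m) → List A) → ColexSorted t m u
    → (i : Fin m)
    → (¬ IsoNodes t (u (inject₁ i)) (u (Fin.suc i)))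
      ⇔ (∃ λ j → InSubtree (u (inject₁ i)) (u (inject₁ j)) × Red t m u j)
corollary1 A _≺_ sto t _ m u enum i = mk⇔ redBelow-of-¬iso ¬iso-of-redBelow
  where
  open TrieTheory A _≺_ sto
  open Enumeration t m u enum
  open ColexSorted enum using (nodes)

  redBelow-of-¬iso : ¬ IsoNodes t (lower i) (upper i) → RedBelow i
  redBelow-of-¬iso ¬iso =
    let s , eq = nodes (inject₁ i)
    in [ ⊥-elim ∘ ¬iso , id ]′ (iso⊎redBelow (childOf-wellFounded s) i eq)

  ¬iso-of-redBelow : RedBelow i → ¬ IsoNodes t (lower i) (upper i)
  ¬iso-of-redBelow (j , (r , lj≡) , red) i-iso =
    red (IsoNodes⇒SameOut t (lower j) (upper j) (iso-descends {i} {j} r lj≡ i-iso))
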